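{- For every wff $\mathbf{A}_\alpha$ of $\mathcal{Q}^{\rm u}_{0}$, $\vdash\mathbf{A}_\alpha\simeq\mathbf{A}_\alpha$.
   Context: SYNTAX. Type symbols: $\imath$, $o$, and $(\alpha\beta)$ for types $\alpha,\beta$ (functions from $\beta$ to $\alpha$). Primitive symbols: $[$, $]$, $\lambda$; denumerably many variables of each type; logical constants $\mathrm{Q}_{o\alpha\alpha}$ (every $\alpha$) and $\iota_{\alpha(o\alpha)}$ ($\alpha\neq o$); nonlogical constants of various types. Wffs: variables and primitive constants of type $\alpha$; $[\mathbf{A}_{\alpha\beta}\mathbf{B}_\beta]$ of type $\alpha$; $[\lambda\mathbf{x}_\beta\mathbf{A}_\alpha]$ of type $\alpha\beta$. $\mathrm{S}^{\mathbf{x}_\alpha}_{\mathbf{A}_\alpha}\mathbf{B}$ is substitution for free occurrences. ABBREVIATIONS. $[\mathbf{A}_\alpha=\mathbf{B}_\alpha]$ is $[\mathrm{Q}_{o\alpha\alpha}\mathbf{A}_\alpha\mathbf{B}_\alpha]$; $T_o$ is $[\mathrm{Q}_{ooo}=\mathrm{Q}_{ooo}]$; $F_o$ is $[[\lambda x_o T_o]=[\lambda x_o x_o]]$; $[\forall\mathbf{x}_\alpha\mathbf{A}_o]$ is $[[\lambda y_\alpha T_o]=[\lambda\mathbf{x}_\alpha\mathbf{A}_o]]$; $[\mathbf{A}_o\wedge\mathbf{B}_o]$ is $[[\lambda x_o\lambda y_o[[\lambda g_{ooo}[g_{ooo}T_oT_o]]=[\lambda g_{ooo}[g_{ooo}x_oy_o]]]]\mathbf{A}_o\mathbf{B}_o]$;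 $[\mathbf{A}_o\supset\mathbf{B}_o]$ is $[[\lambda x_o\lambda y_o[x_o=[x_o\wedge y_o]]]\mathbf{A}_o\mathbf{B}_o]$; $[\sim\mathbf{A}_o]$ is $[\mathrm{Q}_{ooo}F_o\mathbf{A}_o]$; $[\mathbf{A}_o\vee\mathbf{B}_o]$ is $[[\lambda x_o\lambda y_o[\sim[[\sim x_o]\wedge[\sim y_o]]]]\mathbf{A}_o\mathbf{B}_o]$; $[\exists\mathbf{x}_\alpha\mathbf{A}_o]$ is $[\sim[\forall\mathbf{x}_\alpha\sim\mathbf{A}_o]]$; $[\exists_1\mathbf{x}_\alpha\mathbf{A}_o]$ is $[\exists y_\alpha[[\lambda\mathbf{x}_\alpha\mathbf{A}_o]=\mathrm{Q}_{o\alpha\alpha}y_\alpha]]$; $[\mathbf{A}_\alpha\downarrow]$ is $[\exists x_\alpha[x_\alpha=\mathbf{A}_\alpha]]$ ($x_\alpha$ not in $\mathbf{A}_\alpha$); $[\mathbf{A}_\alpha\uparrow]$ is $[\sim[\mathbf{A}_\alpha\downarrow]]$; $[\mathbf{A}_\alpha\simeq\mathbf{B}_\alpha]$ is $[[\mathbf{A}_\alpha\downarrow\vee\mathbf{B}_\alpha\downarrow]\supset[\mathbf{A}_\alpha=\mathbf{B}_\alpha]]$; $[\mathrm{I}\mathbf{x}_\alpha\mathbf{A}_o]$ is $[\iota_{\alpha(o\alpha)}[\lambda\mathbf{x}_\alpha\mathbf{A}_o]]$. PROOF SYSTEM. Axiom schemas A1 $[g_{oo}T_o\wedge g_{oo}F_o]=\forall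 x_o[g_{oo}x_o]$; A2 $[x_\alpha=y_\alpha]\supset[h_{o\alpha}x_\alpha=h_{o\alpha}y_\alpha]$; A3 $[f_{\alpha\beta}=g_{\alpha\beta}]=\forall x_\beta[f_{\alpha\beta}x_\beta\simeq g_{\alpha\beta}x_\beta]$; A4 $\mathbf{A}_\alpha\downarrow\supset[[\lambda\mathbf{x}_\alpha\mathbf{B}_\beta]\mathbf{A}_\alpha\simeq\mathrm{S}^{\mathbf{x}_\alpha}_{\mathbf{A}_\alpha}\mathbf{B}_\beta]$ ($\mathbf{A}_\alpha$ free for $\mathbf{x}_\alpha$ in $\mathbf{B}_\beta$); A5 $\mathbf{x}_\alpha\downarrow$; A6 $\mathbf{c}_\alpha\downarrow$ ($\mathbf{c}_\alpha$ primitive constant); A7 $[\lambda\mathbf{x}_\alpha\mathbf{B}_\beta]\downarrow$; A8 $\mathbf{A}_{o\beta}\mathbf{B}_\beta\downarrow$; A9 $[\mathbf{A}_{o\beta}\uparrow\vee\mathbf{B}_\beta\uparrow]\supset\sim[\mathbf{A}_{o\beta}\mathbf{B}_\beta]$; A10 $[\mathbf{A}_{\alpha\beta}\uparrow\vee\mathbf{B}_\beta\uparrow]\supset[\mathbf{A}_{\alpha\beta}\mathbf{B}_\beta]\uparrow$ ($\alpha\neq o$); A11 $\mathbf{A}_\alpha\downarrow\supset[\mathbf{B}_\alpha\downarrow\supset[[\mathbf{A}_\alpha\simeq\mathbf{B}_\alpha]\simeq[\mathbf{A}_\alpha=\mathbf{B}_\alpha]]]$; A12 $\exists_1\mathbf{x}_\alpha\mathbf{A}_o\supset[[\mathrm{I}\mathbf{x}_\alpha\mathbf{A}_o]\downarrow\wedge\mathrm{S}^{\mathbf{x}_\alpha}_{[\mathrm{I}\mathbf{x}_\alpha\mathbf{A}_o]}\mathbf{A}_o]$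 ($\alpha\neq o$, $\mathrm{I}\mathbf{x}_\alpha\mathbf{A}_o$ free for $\mathbf{x}_\alpha$ in $\mathbf{A}_o$); A13 $\sim[\exists_1\mathbf{x}_\alpha\mathbf{A}_o]\supset[\mathrm{I}\mathbf{x}_\alpha\mathbf{A}_o]\uparrow$ ($\alpha\neq o$). Rules: R1 from $\mathbf{A}_\alpha\simeq\mathbf{B}_\alpha$ and $\mathbf{C}_o$ infer $\mathbf{C}_o$ with one occurrence of $\mathbf{A}_\alpha$ (not an occurrence of a variable immediately preceded by $\lambda$) replaced by $\mathbf{B}_\alpha$; R2 from $\mathbf{A}_o$ and $\mathbf{A}_o\supset\mathbf{B}_o$ infer $\mathbf{B}_o$. A proof is a finite sequence of wffs$_o$ each an axiom instance or obtained from earlier members by R1 or R2; $\vdash\mathbf{A}_o$ means $\mathbf{A}_o$ has a proof. -}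

module Defs where

open import Data.Nat using (ℕ; zero; suc; _⊔_)
open import Data.Nat.Properties using () renaming (_≟_ to _≟ℕ_)
open import Data.Bool using (Bool; true; false; _∧_; _∨_; not; if_then_else_)
open import Data.Unit using (⊤)
open import Data.Product using (_×_)
open import Relation.Nullary using (yes; no; Dec; ¬_)
open import Relation.Nullary.Decidable using (⌊_⌋)
open import Relation.Binary.PropositionalEquality using (_≡_; _≢_; refl; cong₂)
import Data.Bool as B

-- Type symbols: ind (ι), o, and (α ⇐ β) for Church's (αβ): functions from β to α.
-- ⇐ is left-associative, so  o ⇐ α ⇐ α  is Church's  oαα = ((oα)α).
data Ty : Set where
  ind : Ty
  o   : Ty
  _⇐_ : Ty → Ty → Ty

infixl 30 _⇐_

_≟T_ : (α β : Ty) → Dec (α ≡ β)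
ind ≟T ind = yes refl
ind ≟T o = no λ ()
ind ≟T (_ ⇐ _) = no λ ()
o ≟T ind = no λ ()
o ≟T o = yes refl
o ≟T (_ ⇐ _) = no λ ()
(_ ⇐ _) ≟T ind = no λ ()
(_ ⇐ _) ≟T o = no λ ()
(α ⇐ β) ≟T (γ ⇐ δ) with α ≟T γ | β ≟T δ
... | yes refl | yes refl = yes refl
... | no p | _ = no λ { refl → p refl }
... | yes _ | no q = no λ { refl → q refl }

-- The logic Q^u_0 over a language whose nonlogical constants of type α
-- are the elements of C α.
module Q0u (C : Ty → Set) where

  -- Wffs of type α (intrinsically typed).  A variable is a name (ℕ) together
  -- with its type: denumerably many variables of each type.
  data Wff : Ty → Set where
    var  : ℕ → (α : Ty) → Wff α
    con  : ∀ {α} → C α → Wff α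
    Q    : (α : Ty) → Wff (o ⇐ α ⇐ α)
    iota : (α : Ty) → α ≢ o → Wff (α ⇐ (o ⇐ α))
    _·_  : ∀ {α β} → Wff (α ⇐ β) → Wff β → Wff α
    ƛ    : ∀ {α} → ℕ → (β : Ty) → Wff α → Wff (α ⇐ β)

  infixl 40 _·_

  sameVar : ℕ → Ty → ℕ → Ty → Bool
  sameVar n α m β = ⌊ n ≟ℕ m ⌋ ∧ ⌊ α ≟T β ⌋

  occursFree : ℕ → Ty → ∀ {β} → Wff β → Bool
  occursFree x α (var n β) = sameVar n β x α
  occursFree x α (con _) = false
  occursFree x α (Q _) = false
  occursFree x α (iota _ _) = false
  occursFree x α (f · a) = occursFree x α f ∨ occursFree x α a
  occursFree x α (ƛ y β B) = not (sameVar y β x α) ∧ occursFree x α B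

  sub : ℕ → ∀ {α} → Wff α → ∀ {β} → Wff β → Wff β
  sub x {α} A (var n β) with n ≟ℕ x | β ≟T α
  ... | yes refl | yes refl = A
  ... | _ | _ = var n β
  sub x A (con c) = con c
  sub x A (Q γ) = Q γ
  sub x A (iota γ p) = iota γ p
  sub x A (f · a) = sub x A f · sub x A a
  sub x {α} A (ƛ y β B) = if sameVar y β x α then ƛ y β B else ƛ y β (sub x A B)

  FreeFor : ℕ → ∀ {α} → Wff α → ∀ {β} → Wff β → Set
  FreeFor x A (var _ _) = ⊤
  FreeFor x A (con _) = ⊤
  FreeFor x A (Q _) = ⊤
  FreeFor x A (iota _ _) = ⊤
  FreeFor x A (f · a) = FreeFor x A f × FreeFor x A a
  FreeFor x {α} A (ƛ y β B) =
    if sameVar y β x α then ⊤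
    else ((B.T (occursFree x α B) → B.T (not (occursFree y β A))) × FreeFor x A B)

  -- largest variable name occurring (free or bound) in A; suc of it is a
  -- name not occurring in A
  names : ∀ {α} → Wff α → ℕ
  names (var n _) = n
  names (con _) = 0
  names (Q _) = 0
  names (iota _ _) = 0
  names (f · a) = names f ⊔ names a
  names (ƛ y _ B) = y ⊔ names B

  infix 20 _≐_
  _≐_ : ∀ {α} → Wff α → Wff α → Wff o
  _≐_ {α} A B = Q α · A · B

  Tₒ : Wff o
  Tₒ = Q o ≐ Q o

  Fₒ : Wff o
  Fₒ = ƛ 0 o Tₒ ≐ ƛ 0 o (var 0 o)

  ∀' : ℕ → (α : Ty) → Wff o → Wff o
  ∀' x α A = ƛ 0 α Tₒ ≐ ƛ x α A

  andC : Wff (o ⇐ o ⇐ o)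
  andC = ƛ 0 o (ƛ 1 o
           (ƛ 2 (o ⇐ o ⇐ o) (var 2 (o ⇐ o ⇐ o) · Tₒ · Tₒ)
             ≐ ƛ 2 (o ⇐ o ⇐ o) (var 2 (o ⇐ o ⇐ o) · var 0 o · var 1 o)))

  _∧'_ : Wff o → Wff o → Wff o
  A ∧' B = andC · A · B

  impC : Wff (o ⇐ o ⇐ o)
  impC = ƛ 0 o (ƛ 1 o (var 0 o ≐ (var 0 o ∧' var 1 o)))

  _⊃_ : Wff o → Wff o → Wff o
  A ⊃ B = impC · A · B

  ∼ : Wff o → Wff o
  ∼ A = Q o · Fₒ · A

  orC : Wff (o ⇐ o ⇐ o)
  orC = ƛ 0 o (ƛ 1 o (∼ (∼ (var 0 o) ∧' ∼ (var 1 o))))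

  _∨'_ : Wff o → Wff o → Wff o
  A ∨' B = orC · A · B

  ∃' : ℕ → (α : Ty) → Wff o → Wff o
  ∃' x α A = ∼ (∀' x α (∼ A))

  -- ∃₁ x_α A := ∃ y_α [[λ x_α A] = Q_{oαα} y_α], y_α distinct from x_α and not in A
  ∃₁ : ℕ → (α : Ty) → Wff o → Wff o
  ∃₁ x α A = ∃' y α (ƛ x α A ≐ Q α · var y α)
    where y = suc (x ⊔ names A)

  -- A↓ := ∃ x_α [x_α = A], x_α not in A
  _↓ : ∀ {α} → Wff α → Wff o
  _↓ {α} A = ∃' z α (var z α ≐ A)
    where z = suc (names A)

  _↑ : ∀ {α} → Wff α → Wff o
  A ↑ = ∼ (A ↓)

  _≃_ : ∀ {α} → Wff α → Wff α → Wff o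
  A ≃ B = ((A ↓) ∨' (B ↓)) ⊃ (A ≐ B)

  I : ℕ → (α : Ty) → α ≢ o → Wff o → Wff α
  I x α p A = iota α p · ƛ x α A

  -- One occurrence of A_α in C is replaced by B_α, giving C'.
  -- (Variables immediately preceded by λ are not subterms of ƛ, so they
  -- are automatically excluded.)
  data Replace {α} (A B : Wff α) : ∀ {γ} → Wff γ → Wff γ → Set where
    here : Replace A B A B
    appL : ∀ {γ δ} {f f' : Wff (γ ⇐ δ)} {a : Wff δ} →
           Replace A B f f' → Replace A B (f · a) (f' · a)
    appR : ∀ {γ δ} {f : Wff (γ ⇐ δ)} {a a' : Wff δ} →
           Replace A B a a' → Replace A B (f · a) (f · a')
    lamB : ∀ {γ} {y β} {b b' : Wff γ} →
           Replace A B b b' → Replace A B (ƛ y β b) (ƛ y β b')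

  infix 5 ⊢_
  data ⊢_ : Wff o → Set where
    A1  : ⊢ ((var 0 (o ⇐ o) · Tₒ) ∧' (var 0 (o ⇐ o) · Fₒ))
              ≐ ∀' 1 o (var 0 (o ⇐ o) · var 1 o)
    A2  : (α : Ty) →
          ⊢ (var 0 α ≐ var 1 α) ⊃ (var 2 (o ⇐ α) · var 0 α ≐ var 2 (o ⇐ α) · var 1 α)
    A3  : (α β : Ty) →
          ⊢ (var 0 (α ⇐ β) ≐ var 1 (α ⇐ β))
              ≐ ∀' 2 β (var 0 (α ⇐ β) · var 2 β ≃ var 1 (α ⇐ β) · var 2 β)
    A4  : ∀ {α β} (x : ℕ) (A : Wff α) (B : Wff β) → FreeFor x A B →
          ⊢ (A ↓) ⊃ ((ƛ x α B · A) ≃ sub x A B)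
    A5  : (x : ℕ) (α : Ty) → ⊢ var x α ↓
    A6c : ∀ {α} (c : C α) → ⊢ con c ↓
    A6Q : (α : Ty) → ⊢ Q α ↓
    A6ι : (α : Ty) (p : α ≢ o) → ⊢ iota α p ↓
    A7  : ∀ {α} (x : ℕ) (β : Ty) (B : Wff α) → ⊢ ƛ x β B ↓
    A8  : ∀ {β} (A : Wff (o ⇐ β)) (B : Wff β) → ⊢ (A · B) ↓
    A9  : ∀ {β} (A : Wff (o ⇐ β)) (B : Wff β) → ⊢ ((A ↑) ∨' (B ↑)) ⊃ ∼ (A · B)
    A10 : ∀ {α β} → α ≢ o → (A : Wff (α ⇐ β)) (B : Wff β) →
          ⊢ ((A ↑) ∨' (B ↑)) ⊃ ((A · B) ↑)
    A11 : ∀ {α} (A B : Wff α) → ⊢ (A ↓) ⊃ ((B ↓) ⊃ ((A ≃ B) ≃ (A ≐ B)))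
    A12 : (x : ℕ) (α : Ty) (p : α ≢ o) (A : Wff o) → FreeFor x (I x α p A) A →
          ⊢ ∃₁ x α A ⊃ ((I x α p A ↓) ∧' sub x (I x α p A) A)
    A13 : (x : ℕ) (α : Ty) (p : α ≢ o) (A : Wff o) →
          ⊢ ∼ (∃₁ x α A) ⊃ (I x α p A ↑)
    R1  : ∀ {α} {A B : Wff α} {C C' : Wff o} →
          ⊢ A ≃ B → ⊢ C → Replace A B C C' → ⊢ C'
    R2  : ∀ {A B : Wff o} → ⊢ A → ⊢ A ⊃ B → ⊢ B

module Submission where

-- A variable x_γ always denotes (A5), so axiom A4 applied to the
-- β-redex [λx_γ A] x_γ gives  ⊢ [λx_γ A] x_γ ≃ S^{x_γ}_{x_γ} A, and the
-- identity substitution leaves A unchanged; so some wff P is provably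
-- similar to A.  Rule R1 then rewrites, inside the provable wff
-- P ≃ A = [[P↓ ∨ A↓] ⊃ [P = A]], both remaining occurrences of P into A,
-- which yields A ≃ A — provided the bound variable of P↓ is the one of A↓,
-- i.e. P and A have the same largest variable name.

open import Defs
open import Data.Nat using (suc)
open import Data.Nat.Properties using (⊔-identityʳ) renaming (_≟_ to _≟ℕ_)
open import Data.Bool using (true; false; T)
open import Data.Bool.Properties using (T-∧; T-≡; T-not-≡; ¬-not)
open import Data.Unit using (tt)
open import Data.Product using (_×_; _,_)
open import Function.Bundles using (Equivalence)
open import Relation.Nullary using (yes; no)
open import Relation.Nullary.Decidable using (⌊_⌋; toWitness; fromWitness)
open import Relation.Binary.PropositionalEquality using (_≡_; refl; cong; cong₂; subst)

module Reflexivity (C : Ty → Set) where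
  open Q0u C
  open Equivalence using (to; from)

  sameVar-sound : ∀ {n α m β} → T (sameVar n α m β) → n ≡ m × α ≡ β
  sameVar-sound {n} {α} {m} {β} same with to (T-∧ {⌊ n ≟ℕ m ⌋} {⌊ α ≟T β ⌋}) same
  ... | names-equal , types-equal = toWitness names-equal , toWitness types-equal

  sameVar-refl : ∀ n α → T (sameVar n α n α)
  sameVar-refl n α = from (T-∧ {⌊ n ≟ℕ n ⌋} {⌊ α ≟T α ⌋}) (fromWitness refl , fromWitness refl)

  sameVar-sym : ∀ n α m β → T (sameVar n α m β) → T (sameVar m β n α)
  sameVar-sym n α m β same with sameVar-sound {n} {α} {m} {β} same
  ... | refl , refl = sameVar-refl n α

  sameVar-false-sym : ∀ n α m β → sameVar n α m β ≡ false → sameVar m β n α ≡ false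
  sameVar-false-sym n α m β distinct =
    ¬-not λ same → subst T distinct (sameVar-sym m β n α (from T-≡ same))

  sub-self : ∀ x γ {β} (B : Wff β) → sub x (var x γ) B ≡ B
  sub-self x γ (var n β) with n ≟ℕ x | β ≟T γ
  ... | yes refl | yes refl = refl
  ... | yes refl | no _ = refl
  ... | no _ | _ = refl
  sub-self x γ (con c) = refl
  sub-self x γ (Q _) = refl
  sub-self x γ (iota _ _) = refl
  sub-self x γ (f · a) = cong₂ _·_ (sub-self x γ f) (sub-self x γ a)
  sub-self x γ (ƛ y β B) with sameVar y β x γ
  ... | true = refl
  ... | false = cong (ƛ y β) (sub-self x γ B)

  -- A variable is free for itself in any wff: a binder λy_β below which x_γ
  -- is substituted is distinct from x_γ, so y_β is not free in x_γ.
  freeFor-self : ∀ x γ {β} (B : Wff β) → FreeFor x (var x γ) B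
  freeFor-self x γ (var _ _) = tt
  freeFor-self x γ (con _) = tt
  freeFor-self x γ (Q _) = tt
  freeFor-self x γ (iota _ _) = tt
  freeFor-self x γ (f · a) = freeFor-self x γ f , freeFor-self x γ a
  freeFor-self x γ (ƛ y β B) with sameVar y β x γ in distinct
  ... | true = tt
  ... | false = (λ _ → from T-not-≡ (sameVar-false-sym y β x γ distinct)) , freeFor-self x γ B

  replace-in-defined : ∀ {α} z (P A : Wff α) →
                       Replace P A (∃' z α (var z α ≐ P)) (∃' z α (var z α ≐ A))
  replace-in-defined z P A = appR (appR (lamB (appR (appR here))))

  -- Derived rule: if P ≃ A is provable and P↓, A↓ use the same bound
  -- variable, then A ≃ A is provable.  R1 with P ≃ A rewrites first the
  -- P of [P = A], then the P inside P↓.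
  similar-to-self : ∀ {α} {P A : Wff α} → names P ≡ names A → ⊢ P ≃ A → ⊢ A ≃ A
  similar-to-self {α} {P} {A} same-names P≃A =
    subst (λ n → ⊢ (∃' (suc n) α (var (suc n) α ≐ A) ∨' (A ↓)) ⊃ (A ≐ A))
          same-names rewrite-definedness
    where
    rewrite-equation : ⊢ ((P ↓) ∨' (A ↓)) ⊃ (A ≐ A)
    rewrite-equation = R1 P≃A P≃A (appR (appL (appR here)))

    rewrite-definedness : ⊢ (∃' (suc (names P)) α (var (suc (names P)) α ≐ A) ∨' (A ↓)) ⊃ (A ≐ A)
    rewrite-definedness =
      R1 P≃A rewrite-equation
         (appL (appR (appL (appR (replace-in-defined (suc (names P)) P A)))))

  redex-similar : ∀ x γ {β} (B : Wff β) → ⊢ (ƛ x γ B · var x γ) ≃ B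
  redex-similar x γ B =
    subst (λ B' → ⊢ (ƛ x γ B · var x γ) ≃ B') (sub-self x γ B)
          (R2 (A5 x γ) (A4 x (var x γ) B (freeFor-self x γ B)))

lemma1 : (C : Ty → Set) → let open Q0u C in
    ∀ {α : Ty} (A : Wff α) → ⊢ A ≃ A
-- The redex [λx_ι A] x_ι with name 0 has largest name  names A ⊔ 0 = names A.
lemma1 C A = similar-to-self (⊔-identityʳ (names A)) (redex-similar 0 ind A)
  where open Q0u C
        open Reflexivity C
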